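{- Let $a,b,c,d$ be positive integers with $ad > bc$ and $\gcd(a,b) = \gcd(c,d) = 1$, and let $x, y \in \mathbb{Z}$ satisfy $ax + by = 1$. Let $\mathcal{K} := \{ \lambda (a,b) + \mu (c,d) : \lambda, \mu \geq 0 \} \subseteq \mathbb{R}^2$. Then, as an identity of rational functions, \[ \sigma_{\mathcal{K}}(u,v) = \frac{ 1 + u^{ a-y } v^{ b+x } \, \mathrm{c}\left( u^a v^b , u^{ -y} v^x ; cx+dy , ad-bc \right) }{ \left( u^a v^b - 1 \right) \left( u^c v^d - 1 \right) } . \]
   Context: For a polyhedron $\mathcal{P}\subseteq\mathbb{R}^2$, its integer-point transform is $\sigma_{\mathcal{P}}(u,v) := \sum_{(m,n) \in \mathcal{P}\cap\mathbb{Z}^2} u^m v^n$; for a rational cone this series converges on a suitable open region and is identified with the rational function it defines there. For positive integers $a,b$ and indeterminates $u,v$, the Dedekind--Carlitz polynomial is $\mathrm{c}(u,v;a,b) := \sum_{k=1}^{b-1} u^{\lfloor ka/b\rfloor} v^{k-1}$; here indeterminates may be replaced by Laurent monomials such as $u^a v^b$ and $u^{ -y} v^x$. -}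

module Defs where

open import Data.Nat as ℕ using (ℕ; zero; suc)
open import Data.Integer as ℤ using (ℤ; +_; _/ℕ_)
open import Data.Rational as ℚ using (ℚ; 0ℚ)
open import Data.Product using (_×_; _,_; ∃; ∃-syntax)
open import Data.Product.Properties using (≡-dec)
open import Data.List using (List; []; _∷_; map; upTo; filter; length)
open import Relation.Nullary using (Dec; yes; no; ¬_)
open import Relation.Binary.PropositionalEquality using (_≡_)

-- Exponent vectors of Laurent monomials u^m v^n are pairs (m , n) ∈ ℤ².
Exp : Set
Exp = ℤ × ℤ

_⊕_ : Exp → Exp → Exp
(m , n) ⊕ (m' , n') = (m ℤ.+ m' , n ℤ.+ n')

_⊖e_ : Exp → Exp → Exp
(m , n) ⊖e (m' , n') = (m ℤ.- m' , n ℤ.- n')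

-- k-th power of a monomial: scalar multiple of its exponent vector.
_⊙_ : ℤ → Exp → Exp
k ⊙ (m , n) = (k ℤ.* m , k ℤ.* n)

-- A Laurent polynomial with all coefficients 1 (monomials may repeat),
-- given as the list of exponent vectors of its terms.
LaurentPoly01 : Set
LaurentPoly01 = List Exp

coeff : LaurentPoly01 → Exp → ℤ
coeff P e = + length (filter (λ f → ≡-dec ℤ._≟_ ℤ._≟_ f e) P)

-- Dedekind--Carlitz polynomial c(U,V; α, β) = Σ_{k=1}^{β-1} U^⌊kα/β⌋ V^(k-1),
-- with the indeterminates U, V replaced by Laurent monomials with exponent
-- vectors p, q.  (⌊_⌋ is floor division _/ℕ_ on ℤ.)
dcPoly : (p q : Exp) (α : ℤ) (β : ℕ) → LaurentPoly01
dcPoly p q α zero = []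
dcPoly p q α (suc β') =
  map (λ j → ((((+ (suc j)) ℤ.* α) /ℕ (suc β')) ⊙ p) ⊕ ((+ j) ⊙ q)) (upTo β')

-- Formal (Laurent) series in u, v: coefficient functions ℤ² → ℤ.
Series : Set
Series = Exp → ℤ

-- multiplication of a series by the binomial (u^p₁ v^p₂ - 1).
mulMonoMinus1 : Exp → Series → Series
mulMonoMinus1 p f e = f (e ⊖e p) ℤ.- f e

-- The closed cone K = { λ(a,b) + μ(c,d) : λ, μ ≥ 0 }, restricted to points
-- of ℚ² (every lattice point of the real cone has rational λ, μ, since
-- the generators are integral and linearly independent).
InCone : (a b c d : ℕ) → Exp → Set
InCone a b c d (m , n) =
  ∃[ l ] ∃[ μ ] (0ℚ ℚ.≤ l × 0ℚ ℚ.≤ μ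
    × ℚ._/_ m 1 ≡ l ℚ.* ℚ._/_ (+ a) 1 ℚ.+ μ ℚ.* ℚ._/_ (+ c) 1
    × ℚ._/_ n 1 ≡ l ℚ.* ℚ._/_ (+ b) 1 ℚ.+ μ ℚ.* ℚ._/_ (+ d) 1)

-- χ is the coefficient function of the integer-point transform σ_K,
-- i.e. the indicator function of K ∩ ℤ².
IsIntegerPointTransform : (a b c d : ℕ) → Series → Set
IsIntegerPointTransform a b c d χ =
  ∀ e → (InCone a b c d e → χ e ≡ + 1) × (¬ InCone a b c d e → χ e ≡ + 0)

module Submission where

-- Put β = ad − bc and, for e = (m , n) ∈ ℤ², L e = md − nc and M e = an − bm, so
-- that β·e = (L e)·(a , b) + (M e)·(c , d).  Then e ∈ K iff L e ≥ 0 and M e ≥ 0,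
-- so σ_K has coefficient ⟦0 ≤ L e⟧·⟦0 ≤ M e⟧ at e (module Cone, via ℤ → ℚ).
-- Multiplying by u^a v^b − 1 (resp. u^c v^d − 1) subtracts the same product with
-- L (resp. M) lowered by β, so the left-hand side is the indicator of the lattice
-- points of the half-open fundamental parallelogram Π = [0 , β)² in coordinates
-- (L , M) (Coordinates.double-difference, Parallelogram.box-indicator).
-- The right-hand side counts the list 1, u^(a−y) v^(b+x)·(terms of c(…)): its
-- j-th entry is a point of Π with M = j, and a point of Π is determined by M
-- because L + M·(cx + dy) ≡ 0 (mod β) (Parallelogram.enumeration).  The entries
-- land in Π because gcd(c , d) = 1 leaves no lattice point strictly inside the
-- edge [0 , (c , d)].  Generic facts (integer residues, Iverson brackets, list
-- counting, the embedding ℤ → ℚ) come first; lemma6 chains the three steps.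

open import Defs
open import Data.Nat as ℕ using (ℕ; zero; suc; z≤n; s≤s)
import Data.Nat.Properties as ℕP
open import Data.Nat.GCD using (gcd; module Bézout)
open import Data.Nat.Coprimality using (gcd≡1⇒coprime; coprime-Bézout)
open import Data.Integer as ℤ
  using (ℤ; +_; -[1+_]; _+_; _*_; _-_; -_; _≤_; _<_; 0ℤ; 1ℤ; -1ℤ; +≤+; +<+; -<-; _≤?_; _<?_)
import Data.Integer.Properties as ℤP
open import Data.Integer.Tactic.RingSolver using (solve-∀)
open import Data.Integer.DivMod using (_/ℕ_; _%ℕ_; a≡a%ℕn+[a/ℕn]*n; n%ℕd<d)
open import Data.Rational as ℚ using (ℚ; 0ℚ)
import Data.Rational.Properties as ℚP
open import Data.Rational.Solver using (module +-*-Solver)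
open import Data.Rational.Unnormalised as ℚᵘ using (mkℚᵘ; *≡*)
import Data.Rational.Unnormalised.Properties as ℚᵘP
open import Data.List using (List; _∷_; filter; length; applyUpTo; upTo; map)
open import Data.List.Properties using (map-∘; map-upTo; filter-accept; filter-reject)
open import Data.Product using (_×_; _,_; proj₁; proj₂; ∃-syntax)
open import Data.Product.Properties using (≡-dec)
open import Data.Empty using (⊥; ⊥-elim)
open import Function using (_∘_)
open import Relation.Binary.Definitions using (DecidableEquality)
open import Relation.Nullary using (Dec; yes; no; ¬_; contradiction; _×-dec_)
open import Relation.Binary.PropositionalEquality
  using (_≡_; _≢_; refl; sym; trans; cong; cong₂; subst; subst₂; module ≡-Reasoning)

Window : ℤ → ℤ → Set
Window N z = 0ℤ ≤ z × z < N

window? : ∀ N z → Dec (Window N z)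
window? N z = (0ℤ ≤? z) ×-dec (z <? N)

between-−1-and-1 : ∀ t → -1ℤ < t → t < 1ℤ → t ≡ 0ℤ
between-−1-and-1 (+ zero)  _        _               = refl
between-−1-and-1 (+ suc _) _        (+<+ (s≤s ()))
between-−1-and-1 -[1+ _ ]  (-<- ()) _

window-congruence : ∀ n {u v} t → u ≡ v + t * + suc n
  → Window (+ suc n) u → Window (+ suc n) v → t ≡ 0ℤ
window-congruence n {u} {v} t u≡v+tN (0≤u , u<N) (0≤v , v<N) =
  between-−1-and-1 t
    (ℤP.*-cancelʳ-<-nonNeg N (subst₂ _<_ (sym (ℤP.-1*i≡-i N)) (sym tN≡u-v) −N<u-v))
    (ℤP.*-cancelʳ-<-nonNeg N (subst₂ _<_ (sym tN≡u-v) (sym (ℤP.*-identityˡ N)) u-v<N))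
  where
  N : ℤ
  N = + suc n
  tN≡u-v : t * N ≡ u - v
  tN≡u-v = trans (difference v (t * N)) (cong (_- v) (sym u≡v+tN))
    where
    difference : ∀ v w → w ≡ (v + w) - v
    difference = solve-∀
  −N<u-v : - N < u - v
  −N<u-v = subst (_< u - v) (ℤP.+-identityˡ (- N)) (ℤP.+-mono-≤-< 0≤u (ℤP.neg-mono-< v<N))
  u-v<N : u - v < N
  u-v<N = subst (u - v <_) (ℤP.+-identityʳ N) (ℤP.+-mono-<-≤ u<N (ℤP.neg-mono-≤ 0≤v))

residues-differ : ∀ l l′ w s s′ N → l + w ≡ s * N → l′ + w ≡ s′ * N → l ≡ l′ + (s - s′) * N
residues-differ l l′ w s s′ N h h′ = begin
  l                           ≡⟨ rearrange l l′ w ⟩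
  l′ + ((l + w) - (l′ + w))   ≡⟨ cong₂ (λ p q → l′ + (p - q)) h h′ ⟩
  l′ + (s * N - s′ * N)       ≡⟨ cong (λ v → l′ + v) (factor s s′ N) ⟩
  l′ + (s - s′) * N           ∎
  where
  open ≡-Reasoning
  rearrange : ∀ l l′ w → l ≡ l′ + ((l + w) - (l′ + w))
  rearrange = solve-∀
  factor : ∀ s s′ N → s * N - s′ * N ≡ (s - s′) * N
  factor = solve-∀

0≤z-N⇒N≤z : ∀ N z → 0ℤ ≤ z - N → N ≤ z
0≤z-N⇒N≤z N z h = subst₂ _≤_ (ℤP.+-identityˡ N) (cancel z N) (ℤP.+-monoˡ-≤ N h)
  where
  cancel : ∀ z N → (z - N) + N ≡ z
  cancel = solve-∀

positive-difference : ∀ m n → n ℕ.< m → ∃[ k ] (m ℕ.∸ n ≡ suc k × + suc k ≡ + m - + n)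
positive-difference m n n<m with m ℕ.∸ n in m∸n≡
... | zero  = ⊥-elim (ℕP.m>n⇒m∸n≢0 n<m m∸n≡)
... | suc k = k , refl , trans (cong +_ (sym m∸n≡))
                (trans (sym (ℤP.⊖-≥ (ℕP.<⇒≤ n<m))) (sym (ℤP.[+m]-[+n]≡m⊖n m n)))

-- Bézout's identity in the one-sided form produced over ℕ, lifted to ℤ.
bezout-lift : ∀ c d x y → 1 ℕ.+ y ℕ.* d ≡ x ℕ.* c → + c * + x + + d * (- + y) ≡ 1ℤ
bezout-lift c d x y eq = begin
  + c * + x + + d * (- + y)  ≡⟨ rearrange (+ c) (+ d) (+ x) (+ y) ⟩
  + x * + c - + y * + d      ≡⟨ cong₂ _-_ (sym (ℤP.pos-* x c)) (sym (ℤP.pos-* y d)) ⟩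
  + (x ℕ.* c) - + (y ℕ.* d)  ≡⟨ cong (_- + (y ℕ.* d)) (cong +_ (sym eq)) ⟩
  + (1 ℕ.+ y ℕ.* d) - + (y ℕ.* d)  ≡⟨ cong (_- + (y ℕ.* d)) (ℤP.pos-+ 1 (y ℕ.* d)) ⟩
  (1ℤ + + (y ℕ.* d)) - + (y ℕ.* d)  ≡⟨ cancel (+ (y ℕ.* d)) ⟩
  1ℤ ∎
  where
  open ≡-Reasoning
  rearrange : ∀ c d x y → c * x + d * (- y) ≡ x * c - y * d
  rearrange = solve-∀
  cancel : ∀ w → (1ℤ + w) - w ≡ 1ℤ
  cancel = solve-∀

bezout : ∀ c d → gcd c d ≡ 1 → ∃[ X ] ∃[ Y ] (+ c * X + + d * Y ≡ 1ℤ)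
bezout c d gcd≡1 with coprime-Bézout (gcd≡1⇒coprime gcd≡1)
... | Bézout.+- x y eq = + x , - + y , bezout-lift c d x y eq
... | Bézout.-+ x y eq = - + x , + y ,
        trans (ℤP.+-comm (+ c * - + x) (+ d * + y)) (bezout-lift d c y x eq)

⟦_⟧ : {P : Set} → Dec P → ℤ
⟦ yes _ ⟧ = 1ℤ
⟦ no _ ⟧  = 0ℤ

⟦⟧-holds : {P : Set} → P → (p? : Dec P) → ⟦ p? ⟧ ≡ 1ℤ
⟦⟧-holds p (yes _) = refl
⟦⟧-holds p (no ¬p) = contradiction p ¬p

⟦⟧-fails : {P : Set} → ¬ P → (p? : Dec P) → ⟦ p? ⟧ ≡ 0ℤ
⟦⟧-fails ¬p (yes p) = contradiction p ¬p
⟦⟧-fails ¬p (no _)  = refl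

⟦⟧-× : {P Q : Set} (p? : Dec P) (q? : Dec Q) → ⟦ p? ×-dec q? ⟧ ≡ ⟦ p? ⟧ * ⟦ q? ⟧
⟦⟧-× (yes p) (yes q) = ⟦⟧-holds (p , q) (yes p ×-dec yes q)
⟦⟧-× (yes p) (no ¬q) = ⟦⟧-fails (¬q ∘ proj₂) (yes p ×-dec no ¬q)
⟦⟧-× (no ¬p) q?      = ⟦⟧-fails (¬p ∘ proj₁) (no ¬p ×-dec q?)

window-indicator : ∀ N z → 0ℤ ≤ N → ⟦ 0ℤ ≤? z ⟧ - ⟦ 0ℤ ≤? z - N ⟧ ≡ ⟦ window? N z ⟧
window-indicator N z 0≤N = by-cases (0ℤ ≤? z) (z <? N)
  where
  by-cases : (p? : Dec (0ℤ ≤ z)) (q? : Dec (z < N))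
    → ⟦ p? ⟧ - ⟦ 0ℤ ≤? z - N ⟧ ≡ ⟦ p? ×-dec q? ⟧
  by-cases (no z≱0) _ =
    cong (λ w → 0ℤ - w) (⟦⟧-fails (λ h → z≱0 (ℤP.≤-trans 0≤N (0≤z-N⇒N≤z N z h))) (0ℤ ≤? z - N))
  by-cases (yes _) (yes z<N) =
    cong (λ w → 1ℤ - w) (⟦⟧-fails (λ h → ℤP.<⇒≱ z<N (0≤z-N⇒N≤z N z h)) (0ℤ ≤? z - N))
  by-cases (yes _) (no z≮N) =
    cong (λ w → 1ℤ - w) (⟦⟧-holds (ℤP.i≤j⇒0≤j-i (ℤP.≮⇒≥ z≮N)) (0ℤ ≤? z - N))

module Counting {A : Set} (_≟_ : DecidableEquality A) where

  count : List A → A → ℕ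
  count xs e = length (filter (_≟ e) xs)

  count-absent : ∀ n (g : ℕ → A) e → (∀ j → j ℕ.< n → g j ≢ e)
    → count (applyUpTo g n) e ≡ 0
  count-absent zero    g e absent = refl
  count-absent (suc n) g e absent =
    trans (cong length (filter-reject (_≟ e) (absent 0 (s≤s z≤n))))
          (count-absent n (g ∘ suc) e (λ j j<n → absent (suc j) (s≤s j<n)))

  count-unique : ∀ n (g : ℕ → A) e k → k ℕ.< n → g k ≡ e
    → (∀ j → j ℕ.< n → g j ≡ e → j ≡ k) → count (applyUpTo g n) e ≡ 1
  count-unique (suc n) g e zero    _         gk≡e only =
    trans (cong length (filter-accept (_≟ e) gk≡e))
          (cong suc (count-absent n (g ∘ suc) e
            (λ j j<n g1+j≡e → ℕP.1+n≢0 (only (suc j) (s≤s j<n) g1+j≡e))))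
  count-unique (suc n) g e (suc k) (s≤s k<n) gk≡e only =
    trans (cong length (filter-reject (_≟ e) (λ g0≡e → ℕP.0≢1+n (only 0 (s≤s z≤n) g0≡e))))
          (count-unique n (g ∘ suc) e k k<n gk≡e
            (λ j j<n g1+j≡e → ℕP.suc-injective (only (suc j) (s≤s j<n) g1+j≡e)))

ι : ℤ → ℚ
ι z = z ℚ./ 1

-- In the unnormalised rationals ι z is the fraction z / 1 itself; all
-- homomorphism properties of ι are checked there.
ι≃ : ∀ z → ℚ.toℚᵘ (ι z) ℚᵘ.≃ mkℚᵘ z 0
ι≃ z = ℚP.toℚᵘ-fromℚᵘ (mkℚᵘ z 0)

ι-+ : ∀ z w → ι (z + w) ≡ ι z ℚ.+ ι w
ι-+ z w = ℚP.toℚᵘ-injective (begin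
  ℚ.toℚᵘ (ι (z + w))              ≈⟨ ι≃ (z + w) ⟩
  mkℚᵘ (z + w) 0                  ≈⟨ *≡* (cross-multiplied z w) ⟩
  mkℚᵘ z 0 ℚᵘ.+ mkℚᵘ w 0          ≈⟨ ℚᵘP.+-cong (ℚᵘP.≃-sym (ι≃ z)) (ℚᵘP.≃-sym (ι≃ w)) ⟩
  ℚ.toℚᵘ (ι z) ℚᵘ.+ ℚ.toℚᵘ (ι w)  ≈⟨ ℚᵘP.≃-sym (ℚP.toℚᵘ-homo-+ (ι z) (ι w)) ⟩
  ℚ.toℚᵘ (ι z ℚ.+ ι w)            ∎)
  where
  open ℚᵘP.≃-Reasoning
  cross-multiplied : ∀ z w → (z + w) * (+ 1 * + 1) ≡ (z * + 1 + w * + 1) * + 1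
  cross-multiplied = solve-∀

ι-* : ∀ z w → ι (z * w) ≡ ι z ℚ.* ι w
ι-* z w = ℚP.toℚᵘ-injective (begin
  ℚ.toℚᵘ (ι (z * w))              ≈⟨ ι≃ (z * w) ⟩
  mkℚᵘ (z * w) 0                  ≈⟨ *≡* (cross-multiplied z w) ⟩
  mkℚᵘ z 0 ℚᵘ.* mkℚᵘ w 0          ≈⟨ ℚᵘP.*-cong (ℚᵘP.≃-sym (ι≃ z)) (ℚᵘP.≃-sym (ι≃ w)) ⟩
  ℚ.toℚᵘ (ι z) ℚᵘ.* ℚ.toℚᵘ (ι w)  ≈⟨ ℚᵘP.≃-sym (ℚP.toℚᵘ-homo-* (ι z) (ι w)) ⟩
  ℚ.toℚᵘ (ι z ℚ.* ι w)            ∎)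
  where
  open ℚᵘP.≃-Reasoning
  cross-multiplied : ∀ z w → (z * w) * (+ 1 * + 1) ≡ (z * w) * + 1
  cross-multiplied = solve-∀

ι-- : ∀ z w → ι (z - w) ≡ ι z ℚ.- ι w
ι-- z w = trans (ι-+ z (- w)) (cong (ι z ℚ.+_) (ℚP.toℚᵘ-injective (begin
  ℚ.toℚᵘ (ι (- w))      ≈⟨ ι≃ (- w) ⟩
  ℚᵘ.- mkℚᵘ w 0         ≈⟨ ℚᵘP.-‿cong (ℚᵘP.≃-sym (ι≃ w)) ⟩
  ℚᵘ.- ℚ.toℚᵘ (ι w)     ≈⟨ ℚᵘP.≃-sym (ℚP.toℚᵘ-homo‿- (ι w)) ⟩
  ℚ.toℚᵘ (ℚ.- ι w)      ∎)))
  where open ℚᵘP.≃-Reasoning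

ι-cross : ∀ p q r s → ι (p * q - r * s) ≡ ι p ℚ.* ι q ℚ.- ι r ℚ.* ι s
ι-cross p q r s = trans (ι-- (p * q) (r * s)) (cong₂ ℚ._-_ (ι-* p q) (ι-* r s))

ι-nonNeg⁻¹ : ∀ z → 0ℚ ℚ.≤ ι z → 0ℤ ≤ z
ι-nonNeg⁻¹ z 0≤ιz with ℚᵘP.≤-respʳ-≃ (ι≃ z) (ℚP.toℚᵘ-mono-≤ 0≤ιz)
... | ℚᵘ.*≤* 0≤z*1 = subst (0ℤ ≤_) (ℤP.*-identityʳ z) 0≤z*1

/-nonNeg : ∀ z n → 0ℤ ≤ z → 0ℚ ℚ.≤ z ℚ./ suc n
/-nonNeg (+ m) n _ = ℚP.nonNegative⁻¹ _ {{ℚP.normalize-nonNeg m (suc n)}}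

/-*-ι : ∀ z n → (z ℚ./ suc n) ℚ.* ι (+ suc n) ≡ ι z
/-*-ι z n = ℚP.toℚᵘ-injective (begin
  ℚ.toℚᵘ ((z ℚ./ suc n) ℚ.* ι (+ suc n))          ≈⟨ ℚP.toℚᵘ-homo-* (z ℚ./ suc n) (ι (+ suc n)) ⟩
  ℚ.toℚᵘ (z ℚ./ suc n) ℚᵘ.* ℚ.toℚᵘ (ι (+ suc n))  ≈⟨ ℚᵘP.*-cong (ℚP.toℚᵘ-fromℚᵘ (mkℚᵘ z n)) (ι≃ (+ suc n)) ⟩
  mkℚᵘ z n ℚᵘ.* mkℚᵘ (+ suc n) 0                  ≈⟨ *≡* cross-multiplied ⟩
  mkℚᵘ z 0                                        ≈⟨ ℚᵘP.≃-sym (ι≃ z) ⟩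
  ℚ.toℚᵘ (ι z)                                    ∎)
  where
  open ℚᵘP.≃-Reasoning
  drop-unit : ∀ z N → (z * N) * + 1 ≡ z * N
  drop-unit = solve-∀
  cross-multiplied : (z * + suc n) * + 1 ≡ z * + (suc n ℕ.* 1)
  cross-multiplied = trans (drop-unit z (+ suc n)) (cong (λ w → z * + w) (sym (ℕP.*-identityʳ (suc n))))

ι-*-cancelʳ : ∀ n p q → p ℚ.* ι (+ suc n) ≡ q ℚ.* ι (+ suc n) → p ≡ q
ι-*-cancelʳ n p q pN≡qN = begin
  p                  ≡⟨ undo p ⟩
  (p ℚ.* N) ℚ.* N⁻¹  ≡⟨ cong (ℚ._* N⁻¹) pN≡qN ⟩
  (q ℚ.* N) ℚ.* N⁻¹  ≡⟨ sym (undo q) ⟩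
  q                  ∎
  where
  open ≡-Reasoning
  N N⁻¹ : ℚ
  N = ι (+ suc n)
  N⁻¹ = 1ℤ ℚ./ suc n
  undo : ∀ r → r ≡ (r ℚ.* N) ℚ.* N⁻¹
  undo r = begin
    r                        ≡⟨ sym (ℚP.*-identityʳ r) ⟩
    r ℚ.* ι 1ℤ               ≡⟨ cong (r ℚ.*_) (sym (/-*-ι 1ℤ n)) ⟩
    r ℚ.* (N⁻¹ ℚ.* N)        ≡⟨ reassociate r N⁻¹ N ⟩
    (r ℚ.* N) ℚ.* N⁻¹        ∎
    where
    reassociate : ∀ r s t → r ℚ.* (s ℚ.* t) ≡ (r ℚ.* t) ℚ.* s
    reassociate = solve 3 (λ r s t → r :* (s :* t) := (r :* t) :* s) refl
      where open +-*-Solver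

*-nonNeg : ∀ {p q} → 0ℚ ℚ.≤ p → 0ℚ ℚ.≤ q → 0ℚ ℚ.≤ p ℚ.* q
*-nonNeg {p} {q} 0≤p 0≤q = ℚP.nonNegative⁻¹ (p ℚ.* q)
  {{ℚP.nonNeg*nonNeg⇒nonNeg p {{ℚ.nonNegative 0≤p}} q {{ℚ.nonNegative 0≤q}}}}

divide-decomposition : ∀ n m A C L M → + suc n * m ≡ A * L + C * M
  → ι m ≡ (L ℚ./ suc n) ℚ.* ι A ℚ.+ (M ℚ./ suc n) ℚ.* ι C
divide-decomposition n m A C L M Nm≡ = ι-*-cancelʳ n _ _ (begin
  ι m ℚ.* N                                 ≡⟨ sym (ι-* m (+ suc n)) ⟩
  ι (m * + suc n)                           ≡⟨ cong ι (trans (ℤP.*-comm m (+ suc n)) Nm≡) ⟩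
  ι (A * L + C * M)                         ≡⟨ trans (ι-+ (A * L) (C * M)) (cong₂ ℚ._+_ (ι-* A L) (ι-* C M)) ⟩
  ι A ℚ.* ι L ℚ.+ ι C ℚ.* ι M               ≡⟨ cong₂ (λ x y → ι A ℚ.* x ℚ.+ ι C ℚ.* y) (sym (/-*-ι L n)) (sym (/-*-ι M n)) ⟩
  ι A ℚ.* (l ℚ.* N) ℚ.+ ι C ℚ.* (μ ℚ.* N)   ≡⟨ regroup (ι A) (ι C) l μ N ⟩
  (l ℚ.* ι A ℚ.+ μ ℚ.* ι C) ℚ.* N           ∎)
  where
  open ≡-Reasoning
  N l μ : ℚ
  N = ι (+ suc n)
  l = L ℚ./ suc n
  μ = M ℚ./ suc n
  regroup : ∀ a c l μ N → a ℚ.* (l ℚ.* N) ℚ.+ c ℚ.* (μ ℚ.* N) ≡ (l ℚ.* a ℚ.+ μ ℚ.* c) ℚ.* N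
  regroup = solve 5 (λ a c l μ N → a :* (l :* N) :+ c :* (μ :* N) := (l :* a :+ μ :* c) :* N) refl
    where open +-*-Solver

cramer : ∀ (l μ a b c d m n : ℚ) → m ≡ l ℚ.* a ℚ.+ μ ℚ.* c → n ≡ l ℚ.* b ℚ.+ μ ℚ.* d
  → (m ℚ.* d ℚ.- n ℚ.* c ≡ l ℚ.* (a ℚ.* d ℚ.- b ℚ.* c))
  × (a ℚ.* n ℚ.- b ℚ.* m ≡ μ ℚ.* (a ℚ.* d ℚ.- b ℚ.* c))
cramer l μ a b c d _ _ refl refl =
    solve 6 (λ l μ a b c d → (l :* a :+ μ :* c) :* d :- (l :* b :+ μ :* d) :* c
                             := l :* (a :* d :- b :* c)) refl l μ a b c d
  , solve 6 (λ l μ a b c d → a :* (l :* b :+ μ :* d) :- b :* (l :* a :+ μ :* c)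
                             := μ :* (a :* d :- b :* c)) refl l μ a b c d
  where open +-*-Solver

module Coordinates (A B C D : ℤ) (k : ℕ) (hβ : + suc k ≡ A * D - B * C) where

  β : ℤ
  β = + suc k

  L M : Exp → ℤ
  L (m , n) = m * D - n * C
  M (m , n) = A * n - B * m

  decomposition : ∀ m n → (β * m ≡ A * L (m , n) + C * M (m , n))
                        × (β * n ≡ B * L (m , n) + D * M (m , n))
  decomposition m n = trans (cong (_* m) hβ) (first A B C D m n)
                    , trans (cong (_* n) hβ) (second A B C D m n)
    where
    first : ∀ A B C D m n → (A * D - B * C) * m ≡ A * (m * D - n * C) + C * (A * n - B * m)
    first = solve-∀
    second : ∀ A B C D m n → (A * D - B * C) * n ≡ B * (m * D - n * C) + D * (A * n - B * m)
    second = solve-∀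

  coordinates-injective : ∀ e e′ → L e ≡ L e′ → M e ≡ M e′ → e ≡ e′
  coordinates-injective (m , n) (m′ , n′) L≡ M≡ = cong₂ _,_
    (ℤP.*-cancelˡ-≡ β m m′ (trans (proj₁ (decomposition m n))
      (trans (cong₂ (λ l μ → A * l + C * μ) L≡ M≡) (sym (proj₁ (decomposition m′ n′))))))
    (ℤP.*-cancelˡ-≡ β n n′ (trans (proj₂ (decomposition m n))
      (trans (cong₂ (λ l μ → B * l + D * μ) L≡ M≡) (sym (proj₂ (decomposition m′ n′))))))

  L-shift-AB : ∀ e → L (e ⊖e (A , B)) ≡ L e - β
  L-shift-AB (m , n) = trans (expand A B C D m n) (cong (λ w → L (m , n) - w) (sym hβ))
    where
    expand : ∀ A B C D m n → (m - A) * D - (n - B) * C ≡ (m * D - n * C) - (A * D - B * C)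
    expand = solve-∀

  M-shift-AB : ∀ e → M (e ⊖e (A , B)) ≡ M e
  M-shift-AB (m , n) = expand A B m n
    where
    expand : ∀ A B m n → A * (n - B) - B * (m - A) ≡ A * n - B * m
    expand = solve-∀

  L-shift-CD : ∀ e → L (e ⊖e (C , D)) ≡ L e
  L-shift-CD (m , n) = expand C D m n
    where
    expand : ∀ C D m n → (m - C) * D - (n - D) * C ≡ m * D - n * C
    expand = solve-∀

  M-shift-CD : ∀ e → M (e ⊖e (C , D)) ≡ M e - β
  M-shift-CD (m , n) = trans (expand A B C D m n) (cong (λ w → M (m , n) - w) (sym hβ))
    where
    expand : ∀ A B C D m n → A * (n - D) - B * (m - C) ≡ (A * n - B * m) - (A * D - B * C)
    expand = solve-∀

  double-difference : (F G : ℤ → ℤ) (σ : Series) → (∀ e → σ e ≡ F (L e) * G (M e))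
    → ∀ e → mulMonoMinus1 (C , D) (mulMonoMinus1 (A , B) σ) e
          ≡ (F (L e) - F (L e - β)) * (G (M e) - G (M e - β))
  double-difference F G σ σ≡ e = begin
    (σ ((e ⊖e (C , D)) ⊖e (A , B)) - σ (e ⊖e (C , D))) - (σ (e ⊖e (A , B)) - σ e)
      ≡⟨ cong₂ _-_ (cong₂ _-_ at-both at-CD) (cong₂ _-_ at-AB (σ≡ e)) ⟩
    (F (L e - β) * G (M e - β) - F (L e) * G (M e - β)) - (F (L e - β) * G (M e) - F (L e) * G (M e))
      ≡⟨ factorise (F (L e)) (F (L e - β)) (G (M e)) (G (M e - β)) ⟩
    (F (L e) - F (L e - β)) * (G (M e) - G (M e - β)) ∎
    where
    open ≡-Reasoning
    σ-at : ∀ e′ {l μ} → L e′ ≡ l → M e′ ≡ μ → σ e′ ≡ F l * G μ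
    σ-at e′ L≡ M≡ = trans (σ≡ e′) (cong₂ (λ l μ → F l * G μ) L≡ M≡)
    at-both : σ ((e ⊖e (C , D)) ⊖e (A , B)) ≡ F (L e - β) * G (M e - β)
    at-both = σ-at _ (trans (L-shift-AB (e ⊖e (C , D))) (cong (_- β) (L-shift-CD e)))
                     (trans (M-shift-AB (e ⊖e (C , D))) (M-shift-CD e))
    at-CD : σ (e ⊖e (C , D)) ≡ F (L e) * G (M e - β)
    at-CD = σ-at _ (L-shift-CD e) (M-shift-CD e)
    at-AB : σ (e ⊖e (A , B)) ≡ F (L e - β) * G (M e)
    at-AB = σ-at _ (L-shift-AB e) (M-shift-AB e)
    factorise : ∀ f f′ g g′ → (f′ * g′ - f * g′) - (f′ * g - f * g) ≡ (f - f′) * (g - g′)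
    factorise = solve-∀

module Cone (a b c d k : ℕ) (hβ : + suc k ≡ + a * + d - + b * + c) where

  open Coordinates (+ a) (+ b) (+ c) (+ d) k hβ

  det : ℚ
  det = ι (+ a) ℚ.* ι (+ d) ℚ.- ι (+ b) ℚ.* ι (+ c)

  nonNeg-multiple : ∀ z {r} → 0ℚ ℚ.≤ r → ι z ≡ r ℚ.* det → 0ℤ ≤ z
  nonNeg-multiple z {r} 0≤r ιz≡r*det = ι-nonNeg⁻¹ z (subst (0ℚ ℚ.≤_) (sym ιz≡r*β) 0≤r*β)
    where
    ιz≡r*β : ι z ≡ r ℚ.* ι β
    ιz≡r*β = trans ιz≡r*det (cong (r ℚ.*_) (sym (trans (cong ι hβ) (ι-cross (+ a) (+ d) (+ b) (+ c)))))
    0≤r*β : 0ℚ ℚ.≤ r ℚ.* ι β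
    0≤r*β = *-nonNeg 0≤r (/-nonNeg β 0 (+≤+ z≤n))

  -- By Cramer's rule the cone coefficients of e are L e / β and M e / β.
  cone⇒coordinates : ∀ e → InCone a b c d e → 0ℤ ≤ L e × 0ℤ ≤ M e
  cone⇒coordinates (m , n) (l , μ , 0≤l , 0≤μ , m≡ , n≡) =
      nonNeg-multiple (L (m , n)) 0≤l (trans (ι-cross m (+ d) n (+ c)) (proj₁ solved))
    , nonNeg-multiple (M (m , n)) 0≤μ (trans (ι-cross (+ a) n (+ b) m) (proj₂ solved))
    where
    solved : (ι m ℚ.* ι (+ d) ℚ.- ι n ℚ.* ι (+ c) ≡ l ℚ.* det)
           × (ι (+ a) ℚ.* ι n ℚ.- ι (+ b) ℚ.* ι m ≡ μ ℚ.* det)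
    solved = cramer l μ (ι (+ a)) (ι (+ b)) (ι (+ c)) (ι (+ d)) (ι m) (ι n) m≡ n≡

  -- Conversely, L e / β and M e / β are non-negative cone coefficients of e.
  coordinates⇒cone : ∀ e → 0ℤ ≤ L e → 0ℤ ≤ M e → InCone a b c d e
  coordinates⇒cone (m , n) 0≤L 0≤M =
      L (m , n) ℚ./ suc k , M (m , n) ℚ./ suc k
    , /-nonNeg (L (m , n)) k 0≤L , /-nonNeg (M (m , n)) k 0≤M
    , divide-decomposition k m (+ a) (+ c) (L (m , n)) (M (m , n)) (proj₁ (decomposition m n))
    , divide-decomposition k n (+ b) (+ d) (L (m , n)) (M (m , n)) (proj₂ (decomposition m n))

  cone-indicator : ∀ σ → IsIntegerPointTransform a b c d σ
    → ∀ e → σ e ≡ ⟦ 0ℤ ≤? L e ⟧ * ⟦ 0ℤ ≤? M e ⟧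
  cone-indicator σ σ-is-transform e =
    trans (by-cases ((0ℤ ≤? L e) ×-dec (0ℤ ≤? M e))) (⟦⟧-× (0ℤ ≤? L e) (0ℤ ≤? M e))
    where
    by-cases : (p? : Dec (0ℤ ≤ L e × 0ℤ ≤ M e)) → σ e ≡ ⟦ p? ⟧
    by-cases (yes (0≤L , 0≤M)) = proj₁ (σ-is-transform e) (coordinates⇒cone e 0≤L 0≤M)
    by-cases (no ¬coords)      = proj₂ (σ-is-transform e) (¬coords ∘ cone⇒coordinates e)

module Parallelogram (A B C D X Y X′ Y′ : ℤ) (k : ℕ) (hβ : + suc k ≡ A * D - B * C)
  (hxy : A * X + B * Y ≡ 1ℤ) (hcd : C * X′ + D * Y′ ≡ 1ℤ) where

  open Coordinates A B C D k hβ public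
  open Counting (≡-dec ℤ._≟_ ℤ._≟_)

  α : ℤ
  α = C * X + D * Y

  Box : Exp → Set
  Box e = Window β (L e) × Window β (M e)

  box? : ∀ e → Dec (Box e)
  box? e = window? β (L e) ×-dec window? β (M e)

  box-indicator : ∀ σ → (∀ e → σ e ≡ ⟦ 0ℤ ≤? L e ⟧ * ⟦ 0ℤ ≤? M e ⟧)
    → ∀ e → mulMonoMinus1 (C , D) (mulMonoMinus1 (A , B) σ) e ≡ ⟦ box? e ⟧
  box-indicator σ σ≡ e = begin
    mulMonoMinus1 (C , D) (mulMonoMinus1 (A , B) σ) e
      ≡⟨ double-difference (λ z → ⟦ 0ℤ ≤? z ⟧) (λ z → ⟦ 0ℤ ≤? z ⟧) σ σ≡ e ⟩
    (⟦ 0ℤ ≤? L e ⟧ - ⟦ 0ℤ ≤? L e - β ⟧) * (⟦ 0ℤ ≤? M e ⟧ - ⟦ 0ℤ ≤? M e - β ⟧)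
      ≡⟨ cong₂ _*_ (window-indicator β (L e) 0≤β) (window-indicator β (M e) 0≤β) ⟩
    ⟦ window? β (L e) ⟧ * ⟦ window? β (M e) ⟧
      ≡⟨ sym (⟦⟧-× (window? β (L e)) (window? β (M e))) ⟩
    ⟦ box? e ⟧ ∎
    where
    open ≡-Reasoning
    0≤β : 0ℤ ≤ β
    0≤β = +≤+ z≤n

  congruence : ∀ m n → L (m , n) + M (m , n) * α ≡ (m * X + n * Y) * β
  congruence m n = begin
    L (m , n) + M (m , n) * α                    ≡⟨ cong (_+ M (m , n) * α) (sym L*1≡L) ⟩
    L (m , n) * (A * X + B * Y) + M (m , n) * α  ≡⟨ expand A B C D X Y m n ⟩
    (m * X + n * Y) * (A * D - B * C)            ≡⟨ cong ((m * X + n * Y) *_) (sym hβ) ⟩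
    (m * X + n * Y) * β                          ∎
    where
    open ≡-Reasoning
    L*1≡L : L (m , n) * (A * X + B * Y) ≡ L (m , n)
    L*1≡L = trans (cong (L (m , n) *_) hxy) (ℤP.*-identityʳ (L (m , n)))
    expand : ∀ A B C D X Y m n → (m * D - n * C) * (A * X + B * Y) + (A * n - B * m) * (C * X + D * Y)
                                 ≡ (m * X + n * Y) * (A * D - B * C)
    expand = solve-∀

  box-determined-by-M : ∀ e e′ → Box e → Box e′ → M e ≡ M e′ → e ≡ e′
  box-determined-by-M (m , n) (m′ , n′) (L-window , _) (L′-window , _) M≡M′ =
    coordinates-injective (m , n) (m′ , n′) L≡L′ M≡M′
    where
    s s′ : ℤ
    s = m * X + n * Y
    s′ = m′ * X + n′ * Y
    L≡ : L (m , n) ≡ L (m′ , n′) + (s - s′) * β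
    L≡ = residues-differ (L (m , n)) (L (m′ , n′)) (M (m , n) * α) s s′ β (congruence m n)
           (trans (cong (λ μ → L (m′ , n′) + μ * α) M≡M′) (congruence m′ n′))
    L≡L′ : L (m , n) ≡ L (m′ , n′)
    L≡L′ = trans L≡ (trans (cong (λ t → L (m′ , n′) + t * β) s-s′≡0) (ℤP.+-identityʳ (L (m′ , n′))))
      where
      s-s′≡0 : s - s′ ≡ 0ℤ
      s-s′≡0 = window-congruence k (s - s′) L≡ L-window L′-window

  -- Since gcd(C , D) = 1, no lattice point lies strictly between 0 and (C , D).
  primitive-edge : ∀ e → L e ≡ 0ℤ → 0ℤ < M e → M e < β → ⊥
  primitive-edge (m , n) L≡0 0<M M<β = ℤP.<⇒≢ 0<M (sym M≡0)
    where
    μ t : ℤ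
    μ = M (m , n)
    t = m * X′ + n * Y′
    drop-zero : ∀ P w → P * 0ℤ + w ≡ w
    drop-zero = solve-∀
    C*μ≡ : C * μ ≡ β * m
    C*μ≡ = sym (trans (proj₁ (decomposition m n))
                      (trans (cong (λ l → A * l + C * μ) L≡0) (drop-zero A (C * μ))))
    D*μ≡ : D * μ ≡ β * n
    D*μ≡ = sym (trans (proj₂ (decomposition m n))
                      (trans (cong (λ l → B * l + D * μ) L≡0) (drop-zero B (D * μ))))
    μ≡ : μ ≡ 0ℤ + t * β
    μ≡ = begin
      μ                            ≡⟨ sym (trans (cong (μ *_) hcd) (ℤP.*-identityʳ μ)) ⟩
      μ * (C * X′ + D * Y′)        ≡⟨ distribute μ C D X′ Y′ ⟩
      (C * μ) * X′ + (D * μ) * Y′  ≡⟨ cong₂ (λ p q → p * X′ + q * Y′) C*μ≡ D*μ≡ ⟩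
      (β * m) * X′ + (β * n) * Y′  ≡⟨ collect β m n X′ Y′ ⟩
      0ℤ + t * β                   ∎
      where
      open ≡-Reasoning
      distribute : ∀ μ C D X′ Y′ → μ * (C * X′ + D * Y′) ≡ (C * μ) * X′ + (D * μ) * Y′
      distribute = solve-∀
      collect : ∀ β m n X′ Y′ → (β * m) * X′ + (β * n) * Y′ ≡ 0ℤ + (m * X′ + n * Y′) * β
      collect = solve-∀
    M≡0 : μ ≡ 0ℤ
    M≡0 = trans μ≡ (cong (λ t → 0ℤ + t * β) t≡0)
      where
      t≡0 : t ≡ 0ℤ
      t≡0 = window-congruence k t μ≡ (ℤP.<⇒≤ 0<M , M<β) (ℤP.≤-refl , +<+ (s≤s z≤n))

  quotient : ℕ → ℤ
  quotient j = (+ suc j * α) /ℕ suc k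

  remainder : ℕ → ℤ
  remainder j = + ((+ suc j * α) %ℕ suc k)

  -- The exponents of 1 + u^(A−Y) v^(B+X) c(u^A v^B , u^(−Y) v^X ; α , β): the
  -- j-th term of the Dedekind–Carlitz polynomial gives the point with index j + 1.
  point : ℕ → Exp
  point zero    = (0ℤ , 0ℤ)
  point (suc j) = (A - Y , B + X) ⊕ ((quotient j ⊙ (A , B)) ⊕ ((+ j) ⊙ (- Y , X)))

  dcPoly-points : (0ℤ , 0ℤ) ∷ map (λ t → (A - Y , B + X) ⊕ t) (dcPoly (A , B) (- Y , X) α (suc k))
                  ≡ applyUpTo point (suc k)
  dcPoly-points = cong ((0ℤ , 0ℤ) ∷_) (trans (sym (map-∘ (upTo k))) (map-upTo _ k))

  M-point : ∀ j → M (point j) ≡ + j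
  M-point zero    = vanish A B
    where
    vanish : ∀ A B → A * 0ℤ - B * 0ℤ ≡ 0ℤ
    vanish = solve-∀
  M-point (suc j) = trans (expand A B X Y (quotient j) (+ j))
                          (trans (cong ((1ℤ + + j) *_) hxy) (ℤP.*-identityʳ (+ suc j)))
    where
    expand : ∀ A B X Y q j → A * ((B + X) + (q * B + j * X)) - B * ((A - Y) + (q * A + j * (- Y)))
                             ≡ (1ℤ + j) * (A * X + B * Y)
    expand = solve-∀

  L-point : ∀ j → L (point (suc j)) ≡ β - remainder j
  L-point j = begin
    L (point (suc j))
      ≡⟨ expand A B C D X Y q (+ j) ⟩
    (1ℤ + q) * (A * D - B * C) - + suc j * α
      ≡⟨ cong (λ w → (1ℤ + q) * w - + suc j * α) (sym hβ) ⟩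
    (1ℤ + q) * β - + suc j * α
      ≡⟨ cong (λ z → (1ℤ + q) * β - z) (a≡a%ℕn+[a/ℕn]*n (+ suc j * α) (suc k)) ⟩
    (1ℤ + q) * β - (remainder j + q * β)
      ≡⟨ cancel q (remainder j) β ⟩
    β - remainder j ∎
    where
    open ≡-Reasoning
    q : ℤ
    q = quotient j
    expand : ∀ A B C D X Y q j → ((A - Y) + (q * A + j * (- Y))) * D - ((B + X) + (q * B + j * X)) * C
                                 ≡ (1ℤ + q) * (A * D - B * C) - (1ℤ + j) * (C * X + D * Y)
    expand = solve-∀
    cancel : ∀ q r β → (1ℤ + q) * β - (r + q * β) ≡ β - r
    cancel = solve-∀

  point-in-box : ∀ j → j ℕ.< suc k → Box (point j)
  point-in-box j j<β = L-window j j<β , subst (Window β) (sym (M-point j)) (+≤+ z≤n , +<+ j<β)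
    where
    L-window : ∀ j → j ℕ.< suc k → Window β (L (point j))
    L-window zero    _           = ℤP.≤-refl , +<+ (s≤s z≤n)
    L-window (suc j) (s≤s j<k) = subst (Window β) (sym (L-point j)) (0≤β-r , β-r<β)
      where
      r : ℤ
      r = remainder j
      r<β : r < β
      r<β = +<+ (n%ℕd<d (+ suc j * α) (suc k))
      -- r = 0 would put point (j + 1) − (A , B) strictly inside the edge [0 , (C , D)].
      r≢0 : r ≢ 0ℤ
      r≢0 r≡0 = primitive-edge (point (suc j) ⊖e (A , B)) L≡0
        (subst (0ℤ <_) (sym M≡) (+<+ (s≤s z≤n)))
        (subst (_< β) (sym M≡) (+<+ (s≤s j<k)))
        where
        vanish : ∀ β → β - 0ℤ - β ≡ 0ℤ
        vanish = solve-∀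
        L≡0 : L (point (suc j) ⊖e (A , B)) ≡ 0ℤ
        L≡0 = trans (L-shift-AB (point (suc j)))
                (trans (cong (λ w → w - β) (trans (L-point j) (cong (λ w → β - w) r≡0))) (vanish β))
        M≡ : M (point (suc j) ⊖e (A , B)) ≡ + suc j
        M≡ = trans (M-shift-AB (point (suc j))) (M-point (suc j))
      0≤β-r : 0ℤ ≤ β - r
      0≤β-r = ℤP.i≤j⇒0≤j-i (ℤP.<⇒≤ r<β)
      β-r<β : β - r < β
      β-r<β = subst (β - r <_) (ℤP.+-identityʳ β)
                (ℤP.+-monoʳ-< β (ℤP.neg-mono-< (ℤP.≤∧≢⇒< (+≤+ z≤n) (r≢0 ∘ sym))))

  enumeration : ∀ e → + count (applyUpTo point (suc k)) e ≡ ⟦ box? e ⟧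
  enumeration e = by-cases (box? e)
    where
    by-cases : (box-e? : Dec (Box e)) → + count (applyUpTo point (suc k)) e ≡ ⟦ box-e? ⟧
    by-cases (yes box-e) = cong +_ (count-unique (suc k) point e j j<β
        (box-determined-by-M (point j) e (point-in-box j j<β) box-e (trans (M-point j) (sym M≡j)))
        (λ i _ point-i≡e → ℤP.+-injective (trans (sym (M-point i)) (trans (cong M point-i≡e) M≡j))))
      where
      j : ℕ
      j = ℤ.∣ M e ∣
      M≡j : M e ≡ + j
      M≡j = sym (ℤP.0≤i⇒+∣i∣≡i (proj₁ (proj₂ box-e)))
      j<β : j ℕ.< suc k
      j<β = ℤP.drop‿+<+ (subst (_< β) M≡j (proj₂ (proj₂ box-e)))
    by-cases (no ¬box-e) = cong +_ (count-absent (suc k) point e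
        (λ j j<β point-j≡e → ¬box-e (subst Box point-j≡e (point-in-box j j<β))))

lemma6 : (a b c d : ℕ) → 0 ℕ.< a → 0 ℕ.< b → 0 ℕ.< c → 0 ℕ.< d
    → b ℕ.* c ℕ.< a ℕ.* d → gcd a b ≡ 1 → gcd c d ≡ 1
    → (x y : ℤ) → (+ a) ℤ.* x ℤ.+ (+ b) ℤ.* y ≡ + 1
    → (σ : Series) → IsIntegerPointTransform a b c d σ
    → ∀ e → mulMonoMinus1 (+ c , + d) (mulMonoMinus1 (+ a , + b) σ) e
            ≡ coeff ((+ 0 , + 0) ∷ map (λ t → (+ a ℤ.- y , + b ℤ.+ x) ⊕ t)
                       (dcPoly (+ a , + b) (ℤ.- y , x)
                               ((+ c) ℤ.* x ℤ.+ (+ d) ℤ.* y) (a ℕ.* d ℕ.∸ b ℕ.* c))) e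
lemma6 a b c d _ _ _ _ bc<ad _ gcd[c,d]≡1 x y ax+by≡1 σ σ-is-transform e = begin
  mulMonoMinus1 (+ c , + d) (mulMonoMinus1 (+ a , + b) σ) e
    ≡⟨ box-indicator σ (cone-indicator σ σ-is-transform) e ⟩
  ⟦ box? e ⟧
    ≡⟨ sym (enumeration e) ⟩
  coeff (applyUpTo point (suc k)) e
    ≡⟨ cong (λ xs → coeff xs e) (trans (sym dcPoly-points) (cong terms (sym ad∸bc≡1+k))) ⟩
  coeff (terms (a ℕ.* d ℕ.∸ b ℕ.* c)) e ∎
  where
  open ≡-Reasoning
  determinant : ∃[ k ] (a ℕ.* d ℕ.∸ b ℕ.* c ≡ suc k × + suc k ≡ + (a ℕ.* d) - + (b ℕ.* c))
  determinant = positive-difference (a ℕ.* d) (b ℕ.* c) bc<ad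
  k : ℕ
  k = proj₁ determinant
  ad∸bc≡1+k : a ℕ.* d ℕ.∸ b ℕ.* c ≡ suc k
  ad∸bc≡1+k = proj₁ (proj₂ determinant)
  hβ : + suc k ≡ + a * + d - + b * + c
  hβ = trans (proj₂ (proj₂ determinant)) (cong₂ _-_ (ℤP.pos-* a d) (ℤP.pos-* b c))
  coefficients : ∃[ X′ ] ∃[ Y′ ] (+ c * X′ + + d * Y′ ≡ 1ℤ)
  coefficients = bezout c d gcd[c,d]≡1
  open Parallelogram (+ a) (+ b) (+ c) (+ d) x y (proj₁ coefficients) (proj₁ (proj₂ coefficients))
                     k hβ ax+by≡1 (proj₂ (proj₂ coefficients))
  open Cone a b c d k hβ using (cone-indicator)
  terms : ℕ → LaurentPoly01
  terms n = (0ℤ , 0ℤ) ∷ map (λ t → (+ a - y , + b + x) ⊕ t) (dcPoly (+ a , + b) (- y , x) α n)
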